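{- Let $G$ be a graph, $\omega$ an end of $G$, and $\mathcal{R}_{max}$ an inclusion-maximal set of pairwise vertex-disjoint $\omega$-rays. Then a ray $R \subseteq G$ is an $\omega$-ray if and only if $R$ meets the rays of $\mathcal{R}_{max}$ infinitely often, i.e., $R$ contains infinitely many vertices of $\bigcup\{V(Q) : Q \in \mathcal{R}_{max}\}$.
   Context: All graphs are simple and undirected (possibly infinite). A ray is a one-way infinite path. Two rays of $G$ are equivalent if they cannot be separated by finitely many vertices; the equivalence classes are the ends of $G$, and a ray belonging to an end $\omega$ is an $\omega$-ray. -}

module Defs where

open import Level using (0ℓ)
open import Data.Nat using (ℕ; suc; _≥_)
open import Data.List using (List)
open import Data.List.Membership.Propositional using (_∉_)
open import Data.Product using (Σ; ∃; ∃-syntax; _×_; _,_)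
open import Relation.Binary.PropositionalEquality using (_≡_; _≢_)
open import Relation.Nullary using (¬_)
open import Function.Definitions using (Injective)

record Graph : Set₁ where
  field
    V     : Set
    E     : V → V → Set
    sym   : ∀ {u v} → E u v → E v u
    irrefl : ∀ {v} → ¬ E v v
open Graph public

record Ray (G : Graph) : Set where
  field
    seq : ℕ → V G
    inj : Injective _≡_ _≡_ seq
    adj : ∀ n → E G (seq n) (seq (suc n))
open Ray public

-- A walk in G - S from a to b (all its vertices avoid the finite set S).
-- (A walk exists iff a path exists.)
data WalkAvoiding (G : Graph) (S : List (V G)) : V G → V G → Set where
  here : ∀ {a} → a ∉ S → WalkAvoiding G S a a
  step : ∀ {a b c} → a ∉ S → E G a b → WalkAvoiding G S b c → WalkAvoiding G S a c

Equivalent : (G : Graph) → Ray G → Ray G → Set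
Equivalent G R R' = ∀ (S : List (V G)) →
  ∃[ n ] ∃[ m ] WalkAvoiding G S (seq R n) (seq R' m)

-- An end is an equivalence class of rays; we represent the end ω by a
-- representative ray ω, and an ω-ray is a ray equivalent to ω.
IsEndRay : (G : Graph) → (ω : Ray G) → Ray G → Set
IsEndRay G ω R = Equivalent G R ω

Disjoint : (G : Graph) → Ray G → Ray G → Set
Disjoint G R Q = ∀ n m → seq R n ≢ seq Q m

IsMaxDisjointEndRays : (G : Graph) (ω : Ray G) (I : Set) (Q : I → Ray G) → Set
IsMaxDisjointEndRays G ω I Q =
    (∀ i → IsEndRay G ω (Q i))
  × (∀ i j → i ≢ j → Disjoint G (Q i) (Q j))
  × ¬ (Σ (Ray G) λ R → IsEndRay G ω R × (∀ i → Disjoint G R (Q i)))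

MeetsInfinitelyOften : (G : Graph) (I : Set) (Q : I → Ray G) → Ray G → Set
MeetsInfinitelyOften G I Q R =
  ∀ N → ∃[ n ] (n ≥ N × Σ I λ i → ∃[ m ] seq R n ≡ seq (Q i) m)

module Submission where

-- (⇒) If an ω-ray R met ⋃Q only finitely often, some tail of R would avoid
--     every Q i.  A tail of an ω-ray is again an ω-ray, so adding it to Q
--     contradicts maximality.
-- (⇐) Let S be finite.  Each s ∈ S lies on at most one Q i; collect the
--     initial segment of that ray up to s.  This "shadow" of S is finite, so
--     R eventually leaves it; pick a later vertex of R lying on some Q i at
--     position k.  The tail of Q i from k then avoids S, and since Q i is an
--     ω-ray it reaches ω in G - S, giving the required R–ω walk.

open import Defs
open import Axiom.ExcludedMiddle using (ExcludedMiddle)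
open import Axiom.DoubleNegationElimination using (DoubleNegationElimination; em⇒dne)
open import Level using (0ℓ)
open import Function.Bundles using (_⇔_; mk⇔)
open import Function.Definitions using (Injective)
open import Data.Nat using (ℕ; zero; suc; _+_; _∸_; _⊔_; _≤_; _<_; _≥_; s≤s)
open import Data.Nat.Properties using (≤-refl; ≤-reflexive; ≤-trans; +-cancelʳ-≡; ≮⇒≥; <⇒≱; m≤m⊔n; m≤n⊔m; m≤n+m; m∸n+n≡m; m≤n⇒m<n∨m≡n)
open import Data.List using (List; []; _∷_; _++_)
open import Data.List.Membership.Propositional using (_∈_; _∉_)
open import Data.List.Membership.Propositional.Properties using (∈-++⁺ˡ; ∈-++⁺ʳ)
open import Data.List.Relation.Unary.Any using (here; there)
open import Data.Product using (Σ; ∃-syntax; _×_; _,_; proj₁; proj₂)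
open import Data.Sum using (inj₁; inj₂)
open import Data.Empty using (⊥-elim)
open import Relation.Nullary using (¬_; Dec; yes; no)
open import Relation.Binary.PropositionalEquality using (_≡_; _≢_; refl; trans; subst) renaming (sym to ≡-sym)

initial : {A : Set} → (ℕ → A) → ℕ → List A
initial f zero    = []
initial f (suc k) = f k ∷ initial f k

initial-∈ : {A : Set} (f : ℕ → A) → ∀ {p k} → p < k → f p ∈ initial f k
initial-∈ f {p} {suc k} (s≤s p≤k) with m≤n⇒m<n∨m≡n p≤k
... | inj₁ p<k  = there (initial-∈ f p<k)
... | inj₂ refl = here refl

beyond-initial : {A : Set} (f : ℕ → A) → ∀ {n N} → f n ∉ initial f N → N ≤ n
beyond-initial f outside = ≮⇒≥ (λ n<N → outside (initial-∈ f n<N))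

-- An injective sequence eventually leaves every finite set (classically:
-- whether a given point is hit at all is decided by excluded middle).
module _ (em : ExcludedMiddle 0ℓ) {A : Set} (f : ℕ → A) (f-inj : Injective _≡_ _≡_ f) where

  eventually-misses : (b : A) → ∃[ N ] (∀ n → N ≤ n → f n ≢ b)
  eventually-misses b with em {∃[ n ] f n ≡ b}
  ... | no never       = 0 , λ n _ fn≡b → never (n , fn≡b)
  ... | yes (n₀ , hit) = suc n₀ , λ n n₀<n fn≡b →
    <⇒≱ n₀<n (≤-reflexive (f-inj (trans fn≡b (≡-sym hit))))

  eventually-leaves : (B : List A) → ∃[ N ] (∀ n → N ≤ n → f n ∉ B)
  eventually-leaves []      = 0 , λ _ _ ()
  eventually-leaves (b ∷ B) with eventually-misses b | eventually-leaves B
  ... | N₁ , misses-b | N₂ , leaves-B = N₁ ⊔ N₂ , leaves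
    where
    leaves : ∀ n → N₁ ⊔ N₂ ≤ n → f n ∉ b ∷ B
    leaves n le (here fn≡b) = misses-b n (≤-trans (m≤m⊔n N₁ N₂) le) fn≡b
    leaves n le (there ∈B)  = leaves-B n (≤-trans (m≤n⊔m N₁ N₂) le) ∈B

finitely-often : DoubleNegationElimination 0ℓ → {P : ℕ → Set} →
  ¬ (∀ N → ∃[ n ] (n ≥ N × P n)) → ∃[ N ] (∀ n → N ≤ n → ¬ P n)
finitely-often dne not-infinitely = dne λ no-bound →
  not-infinitely λ N → dne λ none-after →
    no-bound (N , λ n N≤n Pn → none-after (n , N≤n , Pn))

module _ {G : Graph} where

  walk-start : ∀ {S a b} → WalkAvoiding G S a b → a ∉ S
  walk-start (here a∉S)     = a∉S
  walk-start (step a∉S _ _) = a∉S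

  _++ʷ_ : ∀ {S a b c} → WalkAvoiding G S a b → WalkAvoiding G S b c → WalkAvoiding G S a c
  here _       ++ʷ w′ = w′
  step a∉S e w ++ʷ w′ = step a∉S e (w ++ʷ w′)

  walk-weaken : ∀ {S T a b} → WalkAvoiding G (S ++ T) a b → WalkAvoiding G S a b
  walk-weaken (here a∉)     = here (λ a∈ → a∉ (∈-++⁺ˡ a∈))
  walk-weaken (step a∉ e w) = step (λ a∈ → a∉ (∈-++⁺ˡ a∈)) e (walk-weaken w)

  along : (R : Ray G) → ∀ {S k} → (∀ k′ → k ≤ k′ → seq R k′ ∉ S) →
          ∀ d → WalkAvoiding G S (seq R k) (seq R (d + k))
  along R {k = k} avoids zero    = here (avoids k ≤-refl)
  along R {k = k} avoids (suc d) =
    along R avoids d ++ʷ step (avoids (d + k) (m≤n+m k d)) (adj R (d + k))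
                              (here (avoids (suc d + k) (m≤n+m k (suc d))))

  tail : Ray G → ℕ → Ray G
  tail R N = record
    { seq = λ d → seq R (d + N)
    ; inj = λ {a} {b} e → +-cancelʳ-≡ N a b (inj R e)
    ; adj = λ d → adj R (d + N)
    }

  -- A tail of a ray is equivalent to everything the ray is equivalent to:
  -- given S, separate from S ∪ {first N vertices of R} instead.
  tail-equivalent : ∀ (R X : Ray G) N → Equivalent G R X → Equivalent G (tail R N) X
  tail-equivalent R X N R∼X S with R∼X (S ++ initial (seq R) N)
  ... | n , m , w = n ∸ N , m ,
    subst (λ i → WalkAvoiding G S (seq R i) (seq X m)) (≡-sym (m∸n+n≡m N≤n)) (walk-weaken w)
    where
    N≤n : N ≤ n
    N≤n = beyond-initial (seq R) (λ n∈ → walk-start w (∈-++⁺ʳ S n∈))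

  tail-reaches : ∀ (Q X : Ray G) {S k} → Equivalent G Q X → (∀ k′ → k ≤ k′ → seq Q k′ ∉ S) →
                 ∃[ m ] WalkAvoiding G S (seq Q k) (seq X m)
  tail-reaches Q X {S} {k} Q∼X avoids with tail-equivalent Q X k Q∼X S
  ... | d , m , w = m , along Q avoids d ++ʷ w

module Maximal (em : ExcludedMiddle 0ℓ) (G : Graph) (ω : Ray G) (I : Set) (Q : I → Ray G)
               (maximal : IsMaxDisjointEndRays G ω I Q) where

  dne : DoubleNegationElimination 0ℓ
  dne = em⇒dne em

  end-rays : ∀ i → IsEndRay G ω (Q i)
  end-rays = proj₁ maximal

  disjoint : ∀ i j → i ≢ j → Disjoint G (Q i) (Q j)
  disjoint = proj₁ (proj₂ maximal)

  no-extension : ¬ (Σ (Ray G) λ R → IsEndRay G ω R × (∀ i → Disjoint G R (Q i)))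
  no-extension = proj₂ (proj₂ maximal)

  OnRays : V G → Set
  OnRays v = Σ I λ i → ∃[ m ] v ≡ seq (Q i) m

  shadowOf : (s : V G) → Dec (OnRays s) → List (V G)
  shadowOf s (yes (i , j , _)) = initial (seq (Q i)) (suc j)
  shadowOf s (no _)            = []

  shadow : List (V G) → List (V G)
  shadow []      = []
  shadow (s ∷ S) = shadowOf s em ++ shadow S

  -- Disjointness of the Q i makes the ray through s unique, so the shadow
  -- of s contains every vertex preceding s on any Q i.
  shadowOf-covers : ∀ {s i k k′} (d : Dec (OnRays s)) →
                    s ≡ seq (Q i) k′ → k ≤ k′ → seq (Q i) k ∈ shadowOf s d
  shadowOf-covers {i = i} {k′ = k′} (no off) s≡ _ = ⊥-elim (off (i , k′ , s≡))
  shadowOf-covers {i = i} {k′ = k′} (yes (i′ , j , s≡′)) s≡ k≤k′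
    with dne (λ i≢i′ → disjoint i i′ i≢i′ k′ j (trans (≡-sym s≡) s≡′))
  ... | refl = initial-∈ (seq (Q i)) (s≤s (subst (_ ≤_) (inj (Q i) (trans (≡-sym s≡) s≡′)) k≤k′))

  -- Hence if seq (Q i) k is outside shadow S, the tail of Q i from k avoids S.
  shadow-covers : ∀ S {i k k′} → seq (Q i) k′ ∈ S → k ≤ k′ → seq (Q i) k ∈ shadow S
  shadow-covers (s ∷ S) (here s≡)  k≤k′ = ∈-++⁺ˡ (shadowOf-covers em (≡-sym s≡) k≤k′)
  shadow-covers (s ∷ S) (there ∈S) k≤k′ = ∈-++⁺ʳ (shadowOf s em) (shadow-covers S ∈S k≤k′)

  module _ (R : Ray G) where

    -- (⇒) Otherwise a tail of R extends the maximal family.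
    forward : IsEndRay G ω R → MeetsInfinitelyOften G I Q R
    forward R∼ω = dne λ not-infinitely →
      let (N , off-rays) = finitely-often dne not-infinitely in
      no-extension (tail R N , tail-equivalent R ω N R∼ω ,
                    λ i n m e → off-rays (n + N) (m≤n+m N n) (i , m , e))

    -- (⇐) A late vertex of R on some Q i sees ω through the tail of Q i.
    backward : MeetsInfinitelyOften G I Q R → IsEndRay G ω R
    backward meets S with eventually-leaves em (seq R) (inj R) (shadow S)
    ... | N , leaves with meets N
    ...   | n , N≤n , i , k , Rn≡ with tail-reaches (Q i) ω (end-rays i) tail-avoids
      where
      tail-avoids : ∀ k′ → k ≤ k′ → seq (Q i) k′ ∉ S
      tail-avoids k′ k≤k′ ∈S =
        leaves n N≤n (subst (_∈ shadow S) (≡-sym Rn≡) (shadow-covers S ∈S k≤k′))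
    ...     | m , w = n , m , subst (λ v → WalkAvoiding G S v (seq ω m)) (≡-sym Rn≡) w

lemma2 : ExcludedMiddle 0ℓ →
    (G : Graph) (ω : Ray G) (I : Set) (Q : I → Ray G) →
    IsMaxDisjointEndRays G ω I Q →
    (R : Ray G) → IsEndRay G ω R ⇔ MeetsInfinitelyOften G I Q R
lemma2 em G ω I Q maximal R = mk⇔ (forward R) (backward R)
  where open Maximal em G ω I Q maximal
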